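{- For every finite set of formulas $\Gamma$ and every formula $\gamma$: if $\Gamma\Vdash\gamma$ (validity in the base-extension semantics), then $\Gamma\vdash\gamma$ (classical consequence).
   Context: Let $\mathbb{C}$ be a denumerable set of contents and $\mathbb{L}=\{c^+,c^-: c\in\mathbb{C}\}$ the literals. Formulas: literals, $\bot$, $\top$, and $\phi\land\psi$, $\phi\lor\psi$, $\phi\to\psi$. Duality: $(c^+)^\bot=c^-$, $(c^-)^\bot=c^+$, $\bot^\bot=\top$, $\top^\bot=\bot$, $(\phi\land\psi)^\bot=\phi^\bot\lor\psi^\bot$, $(\phi\lor\psi)^\bot=\phi^\bot\land\psi^\bot$, $(\phi\to\psi)^\bot=\phi\land\psi^\bot$. Classical consequence: a valuation is $v:\mathbb{L}\to\{0,1\}$ with $v(c^-)=1-v(c^+)$, extended by $v(\bot)=0$, $v(\top)=1$, $\min$ for $\land$, $\max$ for $\lor$, $v(\phi\to\psi)=\max\{1-v(\phi),v(\psi)\}$; $\Gamma\vdash\phi$ iff every valuation giving value $1$ to all members of $\Gamma$ gives $\phi$ value $1$. Bases: an atomic rule is $(L_1\Rightarrow l_1),\ldots,(L_n\Rightarrow l_n)\Rightarrow l$ ($n\ge0$, $l,l_i\in\mathbb{L}$, $L_i\subseteq\mathbb{L}$ finite); a base is a set of atomic rules. Derivability $L\vdash_{\mathcal{B}} l$ ($L\subseteq\mathbb{L}$ finite, $l\in\mathbb{L}\cup\{\bot\}$) is the smallest relation closed under: (REF) $l\in L$ gives $L\vdash_{\mathcal{B}} l$; (APP$_1$) $(\Rightarrow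 l)\in\mathcal{B}$ gives $L\vdash_{\mathcal{B}} l$; (APP$_2$) if $(L_1\Rightarrow l_1),\ldots,(L_n\Rightarrow l_n)\Rightarrow l\in\mathcal{B}$ and $L\cup L_i\vdash_{\mathcal{B}} l_i$ for all $i$ then $L\vdash_{\mathcal{B}} l$; (ABS) $L\vdash_{\mathcal{B}} m$ and $L\vdash_{\mathcal{B}} m^\bot$ give $L\vdash_{\mathcal{B}}\bot$; (DM) $L\cup\{m\}\vdash_{\mathcal{B}}\bot$ gives $L\vdash_{\mathcal{B}} m^\bot$. Support (defined by induction on logical weight): $\Vdash_{\mathcal{B}} l$ iff $\emptyset\vdash_{\mathcal{B}} l$ for $l\in\mathbb{L}$; $\Vdash_{\mathcal{B}}\bot$ iff $\emptyset\vdash_{\mathcal{B}} l$ for all $l\in\mathbb{L}$; $\Vdash_{\mathcal{B}}\top$ always; $\Vdash_{\mathcal{B}}\phi\to\psi$ iff $\{\phi\}\Vdash_{\mathcal{B}}\psi$; $\Vdash_{\mathcal{B}}\phi\land\psi$ iff $\Vdash_{\mathcal{B}}\phi$ and $\Vdash_{\mathcal{B}}\psi$; $\Vdash_{\mathcal{B}}\phi\lor\psi$ iff for all bases $\mathcal{C}\supseteq\mathcal{B}$ and all $l\in\mathbb{L}$, if $\{\phi\}\Vdash_{\mathcal{C}} l$ and $\{\psi\}\Vdash_{\mathcal{C}} l$ then $\Vdash_{\mathcal{C}} l$; for a nonempty finite set $\Delta$, $\Delta\Vdash_{\mathcal{B}}\phi$ iff for all bases $\mathcal{C}\supseteq\mathcal{B}$,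 if $\Vdash_{\mathcal{C}}\delta$ for every $\delta\in\Delta$ then $\Vdash_{\mathcal{C}}\phi$; $\emptyset\Vdash_{\mathcal{B}}\phi$ means $\Vdash_{\mathcal{B}}\phi$. Finally $\Gamma\Vdash\phi$ iff $\Gamma\Vdash_{\mathcal{B}}\phi$ for every base $\mathcal{B}$. -}

module Defs where

open import Data.Nat using (ℕ)
open import Data.Bool using (Bool; true; false; _∧_; _∨_; not)
open import Data.List using (List; []; _∷_; _++_)
open import Data.List.Membership.Propositional using (_∈_)
open import Data.List.Relation.Unary.All using (All)
open import Data.Product using (_×_; _,_; proj₁; proj₂)
open import Relation.Binary.PropositionalEquality using (_≡_)
open import Level using (Level; suc; zero)

Content : Set
Content = ℕ

data Literal : Set where
  pos : Content → Literal
  neg : Content → Literal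

_ᴸ⊥ : Literal → Literal
pos c ᴸ⊥ = neg c
neg c ᴸ⊥ = pos c

data Formula : Set where
  lit  : Literal → Formula
  ⊥f   : Formula
  ⊤f   : Formula
  _∧f_ : Formula → Formula → Formula
  _∨f_ : Formula → Formula → Formula
  _→f_ : Formula → Formula → Formula

_ᶠ⊥ : Formula → Formula
lit l ᶠ⊥ = lit (l ᴸ⊥)
⊥f ᶠ⊥ = ⊤f
⊤f ᶠ⊥ = ⊥f
(φ ∧f ψ) ᶠ⊥ = (φ ᶠ⊥) ∨f (ψ ᶠ⊥)
(φ ∨f ψ) ᶠ⊥ = (φ ᶠ⊥) ∧f (ψ ᶠ⊥)
(φ →f ψ) ᶠ⊥ = φ ∧f (ψ ᶠ⊥)

IsValuation : (Literal → Bool) → Set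
IsValuation v = ∀ c → v (neg c) ≡ not (v (pos c))

eval : (Literal → Bool) → Formula → Bool
eval v (lit l) = v l
eval v ⊥f = false
eval v ⊤f = true
eval v (φ ∧f ψ) = eval v φ ∧ eval v ψ
eval v (φ ∨f ψ) = eval v φ ∨ eval v ψ
eval v (φ →f ψ) = not (eval v φ) ∨ eval v ψ

_⊢c_ : List Formula → Formula → Set
Γ ⊢c φ = ∀ (v : Literal → Bool) → IsValuation v →
         All (λ ψ → eval v ψ ≡ true) Γ → eval v φ ≡ true

-- Atomic rule (L₁ ⇒ l₁), …, (Lₙ ⇒ lₙ) ⇒ l : premises (finite sets of
-- literals as lists) and conclusion.
record AtomicRule : Set where
  constructor _⇒ʳ_
  field
    premises   : List (List Literal × Literal)
    conclusion : Literal
open AtomicRule public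

Base : Set₁
Base = AtomicRule → Set

_⊆B_ : Base → Base → Set
B ⊆B C = ∀ r → B r → C r

data Target : Set where
  tlit : Literal → Target
  t⊥   : Target

data _⊢[_]_ (L : List Literal) (B : Base) : Target → Set where
  REF  : ∀ {l} → l ∈ L → L ⊢[ B ] tlit l
  APP₁ : ∀ {l} → B ([] ⇒ʳ l) → L ⊢[ B ] tlit l
  APP₂ : ∀ {ps l} → B (ps ⇒ʳ l) →
         All (λ p → (L ++ proj₁ p) ⊢[ B ] tlit (proj₂ p)) ps →
         L ⊢[ B ] tlit l
  ABS  : ∀ {m} → L ⊢[ B ] tlit m → L ⊢[ B ] tlit (m ᴸ⊥) → L ⊢[ B ] t⊥
  DM   : ∀ {m} → (m ∷ L) ⊢[ B ] t⊥ → L ⊢[ B ] tlit (m ᴸ⊥)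

-- ⊩_B φ, by induction on φ.  ⊩_B φ → ψ is {φ} ⊩_B ψ, unfolded.
⊩[_]_ : Base → Formula → Set₁
⊩[ B ] lit l = Level.Lift _ ([] ⊢[ B ] tlit l)
⊩[ B ] ⊥f = Level.Lift _ (∀ l → [] ⊢[ B ] tlit l)
⊩[ B ] ⊤f = Level.Lift _ Data.Unit.⊤
  where import Data.Unit
⊩[ B ] (φ ∧f ψ) = (⊩[ B ] φ) × (⊩[ B ] ψ)
⊩[ B ] (φ ∨f ψ) =
  ∀ (C : Base) → B ⊆B C → ∀ (l : Literal) →
    (∀ (D : Base) → C ⊆B D → ⊩[ D ] φ → ⊩[ D ] lit l) →
    (∀ (D : Base) → C ⊆B D → ⊩[ D ] ψ → ⊩[ D ] lit l) →
    ⊩[ C ] lit l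
⊩[ B ] (φ →f ψ) = ∀ (C : Base) → B ⊆B C → ⊩[ C ] φ → ⊩[ C ] ψ

_⊩[_]_ : List Formula → Base → Formula → Set₁
[] ⊩[ B ] φ = ⊩[ B ] φ
(δ ∷ Δ) ⊩[ B ] φ = ∀ (C : Base) → B ⊆B C → All (⊩[ C ]_) (δ ∷ Δ) → ⊩[ C ] φ

_⊩_ : List Formula → Formula → Set₁
Γ ⊩ φ = ∀ (B : Base) → Γ ⊩[ B ] φ

{-# OPTIONS --safe #-}
module Submission where

open import Defs
open import Data.Bool using (Bool; true; false; _∧_; not)
open import Data.Bool.Properties using (not-involutive)
open import Data.Empty using (⊥; ⊥-elim)
open import Data.List using (List; []; _∷_; _++_)
open import Data.List.Relation.Binary.Subset.Propositional using (_⊆_)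
open import Data.List.Relation.Binary.Subset.Propositional.Properties using (∷⁺ʳ; ++⁺ˡ)
open import Data.List.Relation.Unary.All as All using (All; []; _∷_)
open import Data.Product using (Σ; _×_; _,_; proj₁; proj₂)
open import Data.Sum using (_⊎_; inj₁; inj₂)
open import Data.Unit using (tt)
open import Level using (lift; lower)
open import Relation.Binary.PropositionalEquality using (_≡_; refl; sym; trans; cong; cong₂; subst)
open import Relation.Nullary using (¬_)

-- Fix a valuation v and let Bᵥ be the base whose rules are the axioms
-- (⇒ l) for the literals l true under v.  Bᵥ is consistent, since v is
-- a model of everything it derives.  Every extension C of Bᵥ is either
-- trivial (derives every literal, hence supports every formula) or
-- supports exactly the formulas true under v.  So if Γ ⊩ γ,
-- instantiating the validity at Bᵥ shows that γ is true whenever all of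
-- Γ is.

⊆B-refl : ∀ {B} → B ⊆B B
⊆B-refl r x = x

⊆B-trans : ∀ {B C D} → B ⊆B C → C ⊆B D → B ⊆B D
⊆B-trans bc cd r x = cd r (bc r x)

ᴸ⊥-involutive : ∀ l → (l ᴸ⊥) ᴸ⊥ ≡ l
ᴸ⊥-involutive (pos c) = refl
ᴸ⊥-involutive (neg c) = refl

mutual
  ⊢-mono : ∀ {L L′ B C t} → L ⊆ L′ → B ⊆B C → L ⊢[ B ] t → L′ ⊢[ C ] t
  ⊢-mono L⊆L′ bc (REF l∈L)    = REF (L⊆L′ l∈L)
  ⊢-mono L⊆L′ bc (APP₁ r)     = APP₁ (bc _ r)
  ⊢-mono L⊆L′ bc (APP₂ r ds)  = APP₂ (bc _ r) (⊢-mono-premises L⊆L′ bc ds)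
  ⊢-mono L⊆L′ bc (ABS d e)    = ABS (⊢-mono L⊆L′ bc d) (⊢-mono L⊆L′ bc e)
  ⊢-mono L⊆L′ bc (DM {m} d)   = DM (⊢-mono (∷⁺ʳ m L⊆L′) bc d)

  ⊢-mono-premises : ∀ {L L′ B C} {ps : List (List Literal × Literal)} →
                    L ⊆ L′ → B ⊆B C →
                    All (λ p → (L ++ proj₁ p) ⊢[ B ] tlit (proj₂ p)) ps →
                    All (λ p → (L′ ++ proj₁ p) ⊢[ C ] tlit (proj₂ p)) ps
  ⊢-mono-premises L⊆L′ bc []                   = []
  ⊢-mono-premises L⊆L′ bc (_∷_ {x = p} d ds) =
    ⊢-mono (++⁺ˡ (proj₁ p) L⊆L′) bc d ∷ ⊢-mono-premises L⊆L′ bc ds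

Trivial : Base → Set
Trivial C = ∀ l → [] ⊢[ C ] tlit l

Trivial-mono : ∀ {C D} → C ⊆B D → Trivial C → Trivial D
Trivial-mono cd triv l = ⊢-mono (λ ()) cd (triv l)

⊢⊥⇒Trivial : ∀ {C} → [] ⊢[ C ] t⊥ → Trivial C
⊢⊥⇒Trivial {C} d l =
  subst (λ k → [] ⊢[ C ] tlit k) (ᴸ⊥-involutive l) (DM (⊢-mono (λ ()) ⊆B-refl d))

Trivial⇒⊩ : ∀ φ {C} → Trivial C → ⊩[ C ] φ
Trivial⇒⊩ (lit l)  triv                = lift (triv l)
Trivial⇒⊩ ⊥f       triv                = lift triv
Trivial⇒⊩ ⊤f       triv                = lift tt
Trivial⇒⊩ (φ ∧f ψ) triv                = Trivial⇒⊩ φ triv , Trivial⇒⊩ ψ triv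
Trivial⇒⊩ (φ ∨f ψ) triv D cd l _ _     = lift (Trivial-mono cd triv l)
Trivial⇒⊩ (φ →f ψ) triv D cd _         = Trivial⇒⊩ ψ (Trivial-mono cd triv)

⊩-elim : ∀ Γ {B φ} → Γ ⊩[ B ] φ → All (⊩[ B ]_) Γ → ⊩[ B ] φ
⊩-elim []      s _  = s
⊩-elim (_ ∷ _) s ss = s _ ⊆B-refl ss

module Canonical (v : Literal → Bool) (isV : IsValuation v) where

  Bᵥ : Base
  Bᵥ r = (premises r ≡ []) × (v (conclusion r) ≡ true)

  v-ᴸ⊥ : ∀ l → v (l ᴸ⊥) ≡ not (v l)
  v-ᴸ⊥ (pos c) = isV c
  v-ᴸ⊥ (neg c) = trans (sym (not-involutive (v (pos c)))) (cong not (sym (isV c)))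

  false-literal : Σ Literal (λ l → v l ≡ false)
  false-literal with v (pos 0) in eq
  ... | true  = neg 0 , trans (isV 0) (cong not eq)
  ... | false = pos 0 , eq

  ⟦_⟧ : Target → Set
  ⟦ tlit l ⟧ = v l ≡ true
  ⟦ t⊥ ⟧     = ⊥

  Bᵥ-sound : ∀ {L t} → All (λ l → v l ≡ true) L → L ⊢[ Bᵥ ] t → ⟦ t ⟧
  Bᵥ-sound hyps (REF l∈L)          = All.lookup hyps l∈L
  Bᵥ-sound hyps (APP₁ (_ , vl))    = vl
  Bᵥ-sound hyps (APP₂ (_ , vl) _)  = vl
  Bᵥ-sound hyps (ABS {m} d e)
    with () ← trans (sym (Bᵥ-sound hyps e)) (trans (v-ᴸ⊥ m) (cong not (Bᵥ-sound hyps d)))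
  Bᵥ-sound hyps (DM {m} d) with v m in vm
  ... | true  = ⊥-elim (Bᵥ-sound (vm ∷ hyps) d)
  ... | false = trans (v-ᴸ⊥ m) (cong not vm)

  Bᵥ-consistent : ¬ Trivial Bᵥ
  Bᵥ-consistent triv
    with () ← trans (sym (proj₂ false-literal)) (Bᵥ-sound [] (triv (proj₁ false-literal)))

  ⊢-false⇒Trivial : ∀ {C l} → Bᵥ ⊆B C → v l ≡ false → [] ⊢[ C ] tlit l → Trivial C
  ⊢-false⇒Trivial {l = l} bc vl d =
    ⊢⊥⇒Trivial (ABS d (APP₁ (bc _ (refl , trans (v-ᴸ⊥ l) (cong not vl)))))

  mutual
    ⊩⇒true⊎Trivial : ∀ φ {C} → Bᵥ ⊆B C → ⊩[ C ] φ → eval v φ ≡ true ⊎ Trivial C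
    ⊩⇒true⊎Trivial (lit l) bc (lift d) with v l in vl
    ... | true  = inj₁ refl
    ... | false = inj₂ (⊢-false⇒Trivial bc vl d)
    ⊩⇒true⊎Trivial ⊥f bc (lift triv) = inj₂ triv
    ⊩⇒true⊎Trivial ⊤f bc _           = inj₁ refl
    ⊩⇒true⊎Trivial (φ ∧f ψ) bc (sφ , sψ) with ⊩⇒true⊎Trivial φ bc sφ | ⊩⇒true⊎Trivial ψ bc sψ
    ... | inj₁ tφ   | inj₁ tψ = inj₁ (cong₂ _∧_ tφ tψ)
    ... | inj₂ triv | _       = inj₂ triv
    ... | inj₁ _    | inj₂ triv = inj₂ triv
    ⊩⇒true⊎Trivial (φ ∨f ψ) {C} bc s with eval v φ in eφ | eval v ψ in eψ
    ... | true  | _     = inj₁ refl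
    ... | false | true  = inj₁ refl
    ... | false | false =
      inj₂ (⊢-false⇒Trivial bc vl₀ (lower (s C ⊆B-refl l₀ (collapse φ eφ) (collapse ψ eψ))))
      where
      l₀ : Literal
      l₀ = proj₁ false-literal

      vl₀ : v l₀ ≡ false
      vl₀ = proj₂ false-literal

      collapse : ∀ χ → eval v χ ≡ false → ∀ D → C ⊆B D → ⊩[ D ] χ → ⊩[ D ] lit l₀
      collapse χ eχ D cd sχ = Trivial⇒⊩ (lit l₀) (⊩-false⇒Trivial χ (⊆B-trans bc cd) eχ sχ)
    ⊩⇒true⊎Trivial (φ →f ψ) {C} bc s with eval v φ in eφ
    ... | false = inj₁ refl
    ... | true  = ⊩⇒true⊎Trivial ψ bc (s C ⊆B-refl (true⇒⊩ φ bc eφ))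

    ⊩-false⇒Trivial : ∀ φ {C} → Bᵥ ⊆B C → eval v φ ≡ false → ⊩[ C ] φ → Trivial C
    ⊩-false⇒Trivial φ bc eφ s with ⊩⇒true⊎Trivial φ bc s
    ... | inj₂ triv = triv
    ... | inj₁ tφ with () ← trans (sym eφ) tφ

    true⇒⊩ : ∀ φ {C} → Bᵥ ⊆B C → eval v φ ≡ true → ⊩[ C ] φ
    true⇒⊩ (lit l) bc vl = lift (APP₁ (bc _ (refl , vl)))
    true⇒⊩ ⊤f      bc _  = lift tt
    true⇒⊩ (φ ∧f ψ) bc t with eval v φ in eφ | eval v ψ in eψ
    true⇒⊩ (φ ∧f ψ) bc t  | true  | true  = true⇒⊩ φ bc eφ , true⇒⊩ ψ bc eψ
    true⇒⊩ (φ ∧f ψ) bc () | true  | false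
    true⇒⊩ (φ ∧f ψ) bc () | false | _
    true⇒⊩ (φ ∨f ψ) bc t D cd l inl inr with eval v φ in eφ | eval v ψ in eψ
    true⇒⊩ (φ ∨f ψ) bc t  D cd l inl inr | true  | _     = inl D ⊆B-refl (true⇒⊩ φ (⊆B-trans bc cd) eφ)
    true⇒⊩ (φ ∨f ψ) bc t  D cd l inl inr | false | true  = inr D ⊆B-refl (true⇒⊩ ψ (⊆B-trans bc cd) eψ)
    true⇒⊩ (φ ∨f ψ) bc () D cd l inl inr | false | false
    true⇒⊩ (φ →f ψ) bc t D cd sφ with eval v φ in eφ
    ... | false = Trivial⇒⊩ ψ (⊩-false⇒Trivial φ (⊆B-trans bc cd) eφ sφ)
    ... | true  = true⇒⊩ ψ (⊆B-trans bc cd) t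

  ⊩[Bᵥ]⇒true : ∀ φ → ⊩[ Bᵥ ] φ → eval v φ ≡ true
  ⊩[Bᵥ]⇒true φ s with ⊩⇒true⊎Trivial φ ⊆B-refl s
  ... | inj₁ t    = t
  ... | inj₂ triv = ⊥-elim (Bᵥ-consistent triv)

open Canonical using (Bᵥ; true⇒⊩; ⊩[Bᵥ]⇒true)

mainTheorem7 : (Γ : List Formula) (γ : Formula) → Γ ⊩ γ → Γ ⊢c γ
mainTheorem7 Γ γ valid v isV Γ-true =
  ⊩[Bᵥ]⇒true v isV γ
    (⊩-elim Γ (valid (Bᵥ v isV)) (All.map (λ {φ} → true⇒⊩ v isV φ ⊆B-refl) Γ-true))
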